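{- Let $n>1$ be an integer. Then there exists an admissible system of equations $\Phi_n$ whose variables include $y_i$ for $1\le i\le n+1$ and $w$, with the following properties: (1) For any solution of $\Phi_n$ in a division ring $Q$, the variables satisfy $y_i=y_1^i$ for $2\le i\le n+1$, $w=y_1^{n+1}+ny_1^{n-1}+(n-1)y_1^{n-2}$, and $y_1^{n-1}+y_1^{n-2}\neq0$. (2) For any field $K$, there exists a finite set $S\subset K$ of elements algebraic over the prime subfield of $K$ such that for any $t\in K\setminus S$ there exists a solution of $\Phi_n$ in $K$ with $y_1=t$.
   Context: An admissible system of equations is a collection of equations and inequalities in variables $x_0,\dots,x_N$ consisting of $x_0=0$, $x_1=1$, $x_i\neq x_j$ for all $i\neq j$, together with some equations of the form $x_i=x_j+x_k$ (where $j,k\neq0$ and $k\neq i\neq j$) and $x_i=x_j\cdot x_k$ (where $i,j,k\neq0,1$ and $k\neq i\neq j$). A solution in a division ring $Q$ is an assignment of pairwise distinct elements of $Q$ to the variables satisfying all the equations. -}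

module Defs where

open import Level using (Level; _⊔_; Setω) renaming (suc to lsuc)
open import Data.Nat using (ℕ; zero; suc; _∸_; _<_) renaming (_+_ to _+ℕ_)
open import Data.Integer using (ℤ; +_; -[1+_])
open import Data.Fin using (Fin; toℕ) renaming (zero to fzero; suc to fsuc)
open import Data.List using (List; []; _∷_)
open import Data.List.Relation.Unary.All using (All)
open import Data.List.Relation.Unary.Any using (Any)
open import Data.Product using (Σ; _×_)
open import Relation.Nullary using (¬_)
open import Relation.Binary.PropositionalEquality using (_≡_; _≢_)
open import Algebra.Bundles using (Ring)

record DivisionRing (c ℓ : Level) : Set (lsuc (c ⊔ ℓ)) where
  field
    ring : Ring c ℓ
  open Ring ring public
  field
    0≉1     : ¬ (0# ≈ 1#)
    inverse : ∀ x → ¬ (x ≈ 0#) → Σ Carrier (λ y → (y * x ≈ 1#) × (x * y ≈ 1#))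

record Field (c ℓ : Level) : Set (lsuc (c ⊔ ℓ)) where
  field
    divisionRing : DivisionRing c ℓ
  open DivisionRing divisionRing public
  field
    *-comm : ∀ x y → x * y ≈ y * x

data Eqn (m : ℕ) : Set where
  add : (i j k : Fin m) → Eqn m
  mul : (i j k : Fin m) → Eqn m

x₀ : ∀ {N} → Fin (2 +ℕ N)
x₀ = fzero

x₁ : ∀ {N} → Fin (2 +ℕ N)
x₁ = fsuc fzero

AdmissibleEqn : ∀ {N} → Eqn (2 +ℕ N) → Set
AdmissibleEqn (add i j k) = (j ≢ x₀) × (k ≢ x₀) × (k ≢ i) × (i ≢ j)
AdmissibleEqn (mul i j k) =
  (i ≢ x₀) × (i ≢ x₁) × (j ≢ x₀) × (j ≢ x₁) × (k ≢ x₀) × (k ≢ x₁) × (k ≢ i) × (i ≢ j)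

record System : Set where
  field
    N          : ℕ
    eqns       : List (Eqn (2 +ℕ N))
    admissible : All AdmissibleEqn eqns

Var : System → Set
Var Φ = Fin (2 +ℕ System.N Φ)

module _ {c ℓ} (Q : DivisionRing c ℓ) where
  open DivisionRing Q

  Holds : ∀ {m} → (Fin m → Carrier) → Eqn m → Set ℓ
  Holds s (add i j k) = s i ≈ s j + s k
  Holds s (mul i j k) = s i ≈ s j * s k

  record IsSolution (Φ : System) (s : Var Φ → Carrier) : Set ℓ where
    field
      at-x₀    : s x₀ ≈ 0#
      at-x₁    : s x₁ ≈ 1#
      distinct : ∀ i j → i ≢ j → ¬ (s i ≈ s j)
      equations : All (Holds s) (System.eqns Φ)

  _^_ : Carrier → ℕ → Carrier
  x ^ zero  = 1#
  x ^ suc k = x * (x ^ k)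

  _·_ : ℕ → Carrier → Carrier
  zero  · x = 0#
  suc k · x = x + (k · x)

  ℤ· : ℤ → Carrier
  ℤ· (+ k)      = k · 1#
  ℤ· (-[1+ k ]) = - (suc k · 1#)

  InPrimeSubfield : Carrier → Set ℓ
  InPrimeSubfield x =
    Σ ℤ λ a → Σ ℤ λ b → ¬ (ℤ· b ≈ 0#) × (x * ℤ· b ≈ ℤ· a)

  eval : List Carrier → Carrier → Carrier
  eval []       x = 0#
  eval (a ∷ as) x = a + x * eval as x

  AlgebraicOverPrime : Carrier → Set (c ⊔ ℓ)
  AlgebraicOverPrime x =
    Σ (List Carrier) λ cs →
      All InPrimeSubfield cs × Any (λ a → ¬ (a ≈ 0#)) cs × (eval cs x ≈ 0#)

-- The data asserted by Lemma 2.2 for a given n.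
-- y i stands for the variable y_{i+1} (i = 0 … n), w for w.

record Lemma2p2Data (n : ℕ) : Setω where
  field
    Φ     : System
    y     : Fin (suc n) → Var Φ
    w     : Var Φ
    y-distinct : ∀ i j → i ≢ j → y i ≢ y j
    y≢w   : ∀ i → y i ≢ w
    property1 : ∀ {c ℓ} (Q : DivisionRing c ℓ) (s : Var Φ → DivisionRing.Carrier Q) →
      IsSolution Q Φ s →
      let open DivisionRing Q
          _^Q_ = _^_ Q
          _·Q_ = _·_ Q
          t = s (y fzero)
      in (∀ i → s (y i) ≈ t ^Q (1 +ℕ toℕ i))
         × (s w ≈ (t ^Q (n +ℕ 1) + (n ·Q (t ^Q (n ∸ 1)))) + ((n ∸ 1) ·Q (t ^Q (n ∸ 2))))
         × ¬ ((t ^Q (n ∸ 1)) + (t ^Q (n ∸ 2)) ≈ 0#)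
    property2 : ∀ {c ℓ} (K : Field c ℓ) →
      let open Field K
          Q = Field.divisionRing K
      in ¬ ¬ (Σ (List Carrier) λ S →
               All (AlgebraicOverPrime Q) S ×
               (∀ t → ¬ Any (λ u → t ≈ u) S →
                 Σ (Var Φ → Carrier) λ s → IsSolution Q Φ s × (s (y fzero) ≈ t)))

-- Fix t = y₁. Every variable of Φₙ is meant to take a value Σ t^e over a list of exponents: the
-- powers y_{i+1} = t^(i+1), u = t^(n-1) + t^(n-2), w itself, and auxiliary sums that assemble w
-- one monomial at a time, each padded with a fresh power t^(tag j) so that no two partial sums
-- coincide. Read in the order of the construction, each equation determines its new variable
-- from known ones, so in a solution over any division ring every variable has its intended
-- value; this gives (1), with u ≠ 0 because u ≠ x₀.
-- Over a field the intended values satisfy all equations, so they form a solution as soon as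
-- they are pairwise distinct. Two distinct variables differ in a coefficient that is 0 for one
-- and 1 for the other, except w and y_{n+1}, whose difference n t^(n-1) + (n-1) t^(n-2) has
-- consecutive integer coefficients. Either way the difference is a nonzero polynomial over the
-- prime field, so the excluded values of t are among its finitely many roots, all algebraic.
-- Collecting these roots uses excluded middle, which is why (2) is double-negated.

module Submission where

open import Level using (_⊔_)
open import Data.Fin as Fin using (Fin; toℕ; fromℕ<; _↑ˡ_; _↑ʳ_; splitAt; join)
import Data.Fin.Properties as Fin
open import Data.Integer as ℤ using (ℤ; +_; _⊖_)
import Data.Integer.Properties as ℤ
open import Data.Nat as ℕ using (ℕ; zero; suc; _≤_; _<_; z≤n; s≤s) renaming (_+_ to _+ℕ_)
import Data.Nat.Properties as ℕ
open import Data.List using (List; []; _∷_; _++_; replicate; take; length; tabulate; map; allFin; applyUpTo)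
import Data.List.Properties
open import Data.List.Membership.Propositional using (lose)
open import Data.List.Membership.Propositional.Properties using (∈-allFin)
open import Data.List.Relation.Unary.All as All using (All; []; _∷_)
import Data.List.Relation.Unary.All.Properties as All
open import Data.List.Relation.Unary.Any as Any using (Any; here; there)
import Data.List.Relation.Unary.Any.Properties as Any
open import Data.Product using (Σ; _×_; _,_; proj₂)
open import Data.Sum using (_⊎_; inj₁; inj₂; [_,_]′)
open import Effect.Monad using (RawMonad)
open import Function using (_∘_)
open import Relation.Binary.Definitions using (tri<; tri≈; tri>)
open import Relation.Binary.PropositionalEquality as ≡ using (_≡_; _≢_; refl)
open import Relation.Nullary using (¬_; yes; no; recompute; contradiction)
open import Relation.Nullary.Decidable using (¬¬-excluded-middle)
open import Relation.Nullary.Negation using (¬¬-Monad; ¬¬-map)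
open import Defs hiding (_^_; _·_; eval; ℤ·; InPrimeSubfield)
import Defs

δ : ℕ → ℕ → ℕ
δ zero    zero    = 1
δ zero    (suc _) = 0
δ (suc _) zero    = 0
δ (suc a) (suc b) = δ a b

δ-refl : ∀ a → δ a a ≡ 1
δ-refl zero    = refl
δ-refl (suc a) = δ-refl a

δ-≢ : ∀ {a b} → a ≢ b → δ a b ≡ 0
δ-≢ {zero}  {zero}  a≢b = contradiction refl a≢b
δ-≢ {zero}  {suc _} _   = refl
δ-≢ {suc _} {zero}  _   = refl
δ-≢ {suc a} {suc b} a≢b = δ-≢ (a≢b ∘ ≡.cong suc)

multiplicity : ℕ → List ℕ → ℕ
multiplicity e []       = 0
multiplicity e (x ∷ xs) = δ x e +ℕ multiplicity e xs

multiplicity-++ : ∀ e xs ys →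
  multiplicity e (xs ++ ys) ≡ multiplicity e xs +ℕ multiplicity e ys
multiplicity-++ e []       ys = refl
multiplicity-++ e (x ∷ xs) ys =
  ≡.trans (≡.cong (δ x e +ℕ_) (multiplicity-++ e xs ys)) (≡.sym (ℕ.+-assoc (δ x e) _ _))

multiplicity-absent : ∀ {e xs} → All (_≢ e) xs → multiplicity e xs ≡ 0
multiplicity-absent []           = refl
multiplicity-absent (x≢e ∷ xs≢e) = ≡.cong₂ _+ℕ_ (δ-≢ x≢e) (multiplicity-absent xs≢e)

multiplicity-below : ∀ {e xs} → All (_< e) xs → multiplicity e xs ≡ 0
multiplicity-below = multiplicity-absent ∘ All.map ℕ.<⇒≢

multiplicity-once : ∀ {e} xs ys → All (_≢ e) xs → All (_≢ e) ys → multiplicity e (xs ++ e ∷ ys) ≡ 1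
multiplicity-once {e} xs ys xs≢e ys≢e = begin
  multiplicity e (xs ++ e ∷ ys)                 ≡⟨ multiplicity-++ e xs (e ∷ ys) ⟩
  multiplicity e xs +ℕ (δ e e +ℕ multiplicity e ys)
    ≡⟨ ≡.cong₂ (λ a b → a +ℕ (b +ℕ multiplicity e ys)) (multiplicity-absent xs≢e) (δ-refl e) ⟩
  suc (multiplicity e ys)                       ≡⟨ ≡.cong suc (multiplicity-absent ys≢e) ⟩
  1                                             ∎
  where open ≡.≡-Reasoning

multiplicity-replicate : ∀ k a → multiplicity a (replicate k a) ≡ k
multiplicity-replicate zero    a = refl
multiplicity-replicate (suc k) a = ≡.cong₂ _+ℕ_ (δ-refl a) (multiplicity-replicate k a)

¬All⇒¬¬Any¬ : ∀ {a p} {A : Set a} {P : A → Set p} {xs} → ¬ All P xs → ¬ ¬ Any (¬_ ∘ P) xs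
¬All⇒¬¬Any¬ {xs = []}     ¬all ¬any = ¬all []
¬All⇒¬¬Any¬ {xs = x ∷ xs} ¬all ¬any =
  ¬All⇒¬¬Any¬ (λ all-xs → ¬any (here (λ px → ¬all (px ∷ all-xs)))) (¬any ∘ there)

nth : List ℕ → ℕ → ℕ
nth []       _       = 0
nth (x ∷ xs) zero    = x
nth (x ∷ xs) (suc k) = nth xs k

take-suc-nth : ∀ xs k → .(k < length xs) → take (suc k) xs ≡ take k xs ++ nth xs k ∷ []
take-suc-nth xs k k<n = go xs k (recompute (k ℕ.<? length xs) k<n)
  where
  go : ∀ xs k → k < length xs → take (suc k) xs ≡ take k xs ++ nth xs k ∷ []
  go (x ∷ xs) zero    _         = refl
  go (x ∷ xs) (suc k) (s≤s k<n) = ≡.cong (x ∷_) (go xs k k<n)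

All-nth : ∀ {p} {P : ℕ → Set p} {xs} k → P 0 → All P xs → P (nth xs k)
All-nth k       P0 []         = P0
All-nth zero    P0 (px ∷ _)   = px
All-nth (suc k) P0 (_ ∷ pxs)  = All-nth k P0 pxs

tabulate< : ∀ {a} {A : Set a} m → ((k : ℕ) → .(k < m) → A) → List A
tabulate< m f = tabulate (λ i → f (toℕ i) (Fin.toℕ<n i))

module _ {a p} {A : Set a} {P : A → Set p} {m} {f : (k : ℕ) → .(k < m) → A} where

  All-tabulate<⁺ : (∀ k .(k<m : k < m) → P (f k k<m)) → All P (tabulate< m f)
  All-tabulate<⁺ Pf = All.tabulate⁺ (λ i → Pf (toℕ i) (Fin.toℕ<n i))

  All-tabulate<⁻ : All P (tabulate< m f) → ∀ k .(k<m : k < m) → P (f k k<m)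
  All-tabulate<⁻ all k k<m = transport (Fin.toℕ-fromℕ< k<m) (All.tabulate⁻ all (fromℕ< k<m))
    where
    transport : ∀ {k k′} .{h h′} → k ≡ k′ → P (f k h) → P (f k′ h′)
    transport refl Pfk = Pfk

module DivisionRingTheory {c ℓ} (Q : DivisionRing c ℓ) where

  open DivisionRing Q renaming (refl to ≈-refl)
  open import Algebra.Properties.Ring ring
  open import Relation.Binary.Reasoning.Setoid setoid
  open import Algebra.Solver.CommutativeMonoid +-commutativeMonoid using (solve; _⊜_; _⊕_; id)

  infixr 8 _^_
  _^_ : Carrier → ℕ → Carrier
  _^_ = Defs._^_ Q

  infixr 7 _·_
  _·_ : ℕ → Carrier → Carrier
  _·_ = Defs._·_ Q

  eval : List Carrier → Carrier → Carrier
  eval = Defs.eval Q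

  ℤ· : ℤ → Carrier
  ℤ· = Defs.ℤ· Q

  InPrimeSubfield : Carrier → Set ℓ
  InPrimeSubfield = Defs.InPrimeSubfield Q

  ·1-homo-+ : ∀ a b → (a +ℕ b) · 1# ≈ a · 1# + b · 1#
  ·1-homo-+ zero    b = sym (+-identityˡ _)
  ·1-homo-+ (suc a) b = trans (+-congˡ (·1-homo-+ a b)) (sym (+-assoc _ _ _))

  ℤ·-⊖ : ∀ a b → ℤ· (a ⊖ b) ≈ a · 1# - b · 1#
  ℤ·-⊖ a       zero    = sym (trans (+-congˡ -0#≈0#) (+-identityʳ _))
  ℤ·-⊖ zero    (suc b) = sym (+-identityˡ _)
  ℤ·-⊖ (suc a) (suc b) = begin
    ℤ· (suc a ⊖ suc b)             ≡⟨ ≡.cong ℤ· (ℤ.[1+m]⊖[1+n]≡m⊖n a b) ⟩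
    ℤ· (a ⊖ b)                     ≈⟨ ℤ·-⊖ a b ⟩
    a · 1# - b · 1#                ≈⟨ +-identityˡ _ ⟨
    0# + (a · 1# - b · 1#)         ≈⟨ +-congʳ (-‿inverseʳ 1#) ⟨
    (1# - 1#) + (a · 1# - b · 1#)
      ≈⟨ solve 4 (λ x y -x -y → (x ⊕ -x) ⊕ (y ⊕ -y) ⊜ (x ⊕ y) ⊕ (-x ⊕ -y)) ≈-refl _ _ _ _ ⟩
    (1# + a · 1#) + (- 1# - b · 1#) ≈⟨ +-congˡ (-‿+-comm 1# (b · 1#)) ⟩
    (1# + a · 1#) - (1# + b · 1#)  ∎

  x*y≈0⇒y≈0 : ∀ {x y} → ¬ (x ≈ 0#) → x * y ≈ 0# → y ≈ 0#
  x*y≈0⇒y≈0 {x} {y} x≉0 xy≈0 with inverse x x≉0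
  ... | x⁻¹ , x⁻¹x≈1 , _ = begin
    y              ≈⟨ *-identityˡ y ⟨
    1# * y         ≈⟨ *-congʳ x⁻¹x≈1 ⟨
    (x⁻¹ * x) * y  ≈⟨ *-assoc x⁻¹ x y ⟩
    x⁻¹ * (x * y)  ≈⟨ *-congˡ xy≈0 ⟩
    x⁻¹ * 0#       ≈⟨ zeroʳ x⁻¹ ⟩
    0#             ∎

  module _ {x a b x′ a′ b′ : Carrier} where

    sum-determined : x ≈ a + b → x′ ≈ a′ + b′ → a ≈ a′ → b ≈ b′ → x ≈ x′
    sum-determined sat sat′ a≈a′ b≈b′ = trans sat (trans (+-cong a≈a′ b≈b′) (sym sat′))

    left-summand-determined : x ≈ a + b → x′ ≈ a′ + b′ → x ≈ x′ → b ≈ b′ → a ≈ a′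
    left-summand-determined sat sat′ x≈x′ b≈b′ =
      +-cancelʳ b′ a a′ (trans (+-congˡ (sym b≈b′)) (trans (sym sat) (trans x≈x′ sat′)))

    right-summand-determined : x ≈ a + b → x′ ≈ a′ + b′ → x ≈ x′ → a ≈ a′ → b ≈ b′
    right-summand-determined sat sat′ x≈x′ a≈a′ =
      +-cancelˡ a′ b b′ (trans (+-congʳ (sym a≈a′)) (trans (sym sat) (trans x≈x′ sat′)))

    product-determined : x ≈ a * b → x′ ≈ a′ * b′ → a ≈ a′ → b ≈ b′ → x ≈ x′
    product-determined sat sat′ a≈a′ b≈b′ = trans sat (trans (*-cong a≈a′ b≈b′) (sym sat′))

  1+0≉0 : ¬ (1# + 0# ≈ 0#)
  1+0≉0 1+0≈0 = 0≉1 (sym (trans (sym (+-identityʳ 1#)) 1+0≈0))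

  ·1-difference-inPrimeSubfield : ∀ a b → InPrimeSubfield (a · 1# - b · 1#)
  ·1-difference-inPrimeSubfield a b = a ⊖ b , + 1 , 1+0≉0 , (begin
    (a · 1# - b · 1#) * (1# + 0#)  ≈⟨ *-congˡ (+-identityʳ 1#) ⟩
    (a · 1# - b · 1#) * 1#         ≈⟨ *-identityʳ _ ⟩
    a · 1# - b · 1#                ≈⟨ ℤ·-⊖ a b ⟨
    ℤ· (a ⊖ b)                     ∎)

  powerSum : List ℕ → Carrier → Carrier
  powerSum []       t = 0#
  powerSum (e ∷ es) t = t ^ e + powerSum es t

  powerSum-++ : ∀ xs ys t → powerSum (xs ++ ys) t ≈ powerSum xs t + powerSum ys t
  powerSum-++ []       ys t = sym (+-identityˡ _)
  powerSum-++ (x ∷ xs) ys t = trans (+-congˡ (powerSum-++ xs ys t)) (sym (+-assoc _ _ _))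

  powerSum-replicate : ∀ k e t → powerSum (replicate k e) t ≡ k · t ^ e
  powerSum-replicate zero    e t = ≡.refl
  powerSum-replicate (suc k) e t = ≡.cong (_+_ (t ^ e)) (powerSum-replicate k e t)

  module _ {t : Carrier} where

    eval-applyUpTo-cong : ∀ D {f g} → (∀ e → f e ≈ g e) →
      eval (applyUpTo f D) t ≈ eval (applyUpTo g D) t
    eval-applyUpTo-cong zero    f≈g = ≈-refl
    eval-applyUpTo-cong (suc D) f≈g = +-cong (f≈g 0) (*-congˡ (eval-applyUpTo-cong D (f≈g ∘ suc)))

    eval-applyUpTo-0# : ∀ D → eval (applyUpTo (λ _ → 0#) D) t ≈ 0#
    eval-applyUpTo-0# zero    = ≈-refl
    eval-applyUpTo-0# (suc D) = begin
      0# + t * eval (applyUpTo (λ _ → 0#) D) t  ≈⟨ +-identityˡ _ ⟩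
      t * eval (applyUpTo (λ _ → 0#) D) t       ≈⟨ *-congˡ (eval-applyUpTo-0# D) ⟩
      t * 0#                                    ≈⟨ zeroʳ t ⟩
      0#                                        ∎

    eval-applyUpTo-+ : ∀ D f g → eval (applyUpTo (λ e → f e + g e) D) t ≈
      eval (applyUpTo f D) t + eval (applyUpTo g D) t
    eval-applyUpTo-+ zero    f g = sym (+-identityˡ 0#)
    eval-applyUpTo-+ (suc D) f g = begin
      (f 0 + g 0) + t * eval (applyUpTo (λ e → f (suc e) + g (suc e)) D) t
        ≈⟨ +-congˡ (*-congˡ (eval-applyUpTo-+ D (f ∘ suc) (g ∘ suc))) ⟩
      (f 0 + g 0) + t * (F + G)      ≈⟨ +-congˡ (distribˡ t F G) ⟩
      (f 0 + g 0) + (t * F + t * G)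
        ≈⟨ solve 4 (λ a b c d → (a ⊕ b) ⊕ (c ⊕ d) ⊜ (a ⊕ c) ⊕ (b ⊕ d)) ≈-refl _ _ _ _ ⟩
      (f 0 + t * F) + (g 0 + t * G)  ∎
      where
      F = eval (applyUpTo (f ∘ suc) D) t
      G = eval (applyUpTo (g ∘ suc) D) t

    eval-applyUpTo-‿ : ∀ D f → eval (applyUpTo (λ e → - f e) D) t ≈ - eval (applyUpTo f D) t
    eval-applyUpTo-‿ zero    f = sym -0#≈0#
    eval-applyUpTo-‿ (suc D) f = begin
      - f 0 + t * eval (applyUpTo (λ e → - f (suc e)) D) t
        ≈⟨ +-congˡ (*-congˡ (eval-applyUpTo-‿ D (f ∘ suc))) ⟩
      - f 0 + t * - F                                       ≈⟨ +-congˡ (-‿distribʳ-* t F) ⟨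
      - f 0 + - (t * F)                                     ≈⟨ -‿+-comm (f 0) (t * F) ⟩
      - (f 0 + t * F)                                       ∎
      where F = eval (applyUpTo (f ∘ suc) D) t

    eval-applyUpTo-δ : ∀ {x} D → x < D → eval (applyUpTo (λ e → δ x e · 1#) D) t ≈ t ^ x
    eval-applyUpTo-δ {zero} (suc D) _ = begin
      (1# + 0#) + t * eval (applyUpTo (λ _ → 0#) D) t
        ≈⟨ +-cong (+-identityʳ 1#) (*-congˡ (eval-applyUpTo-0# D)) ⟩
      1# + t * 0#                                     ≈⟨ +-congˡ (zeroʳ t) ⟩
      1# + 0#                                         ≈⟨ +-identityʳ 1# ⟩
      1#                                              ∎
    eval-applyUpTo-δ {suc x} (suc D) (s≤s x<D) =
      trans (+-identityˡ _) (*-congˡ (eval-applyUpTo-δ D x<D))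

    eval-applyUpTo-multiplicity : ∀ {D xs} → All (_< D) xs →
      eval (applyUpTo (λ e → multiplicity e xs · 1#) D) t ≈ powerSum xs t
    eval-applyUpTo-multiplicity {D} []                = eval-applyUpTo-0# D
    eval-applyUpTo-multiplicity {D} {x ∷ xs} (x<D ∷ xs<D) = begin
      eval (applyUpTo (λ e → (δ x e +ℕ multiplicity e xs) · 1#) D) t
        ≈⟨ eval-applyUpTo-cong D (λ e → ·1-homo-+ (δ x e) (multiplicity e xs)) ⟩
      eval (applyUpTo (λ e → δ x e · 1# + multiplicity e xs · 1#) D) t
        ≈⟨ eval-applyUpTo-+ D _ _ ⟩
      eval (applyUpTo (λ e → δ x e · 1#) D) t + eval (applyUpTo (λ e → multiplicity e xs · 1#) D) t
        ≈⟨ +-cong (eval-applyUpTo-δ D x<D) (eval-applyUpTo-multiplicity xs<D) ⟩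
      t ^ x + powerSum xs t  ∎

  differencePolynomial : ℕ → List ℕ → List ℕ → List Carrier
  differencePolynomial D xs ys = applyUpTo (λ e → multiplicity e xs · 1# - multiplicity e ys · 1#) D

  eval-differencePolynomial : ∀ {D xs ys} t → All (_< D) xs → All (_< D) ys →
    eval (differencePolynomial D xs ys) t ≈ powerSum xs t - powerSum ys t
  eval-differencePolynomial {D} {xs} {ys} t xs<D ys<D = begin
    eval (differencePolynomial D xs ys) t  ≈⟨ eval-applyUpTo-+ D f (λ e → - g e) ⟩
    F + eval (applyUpTo (λ e → - g e) D) t ≈⟨ +-congˡ (eval-applyUpTo-‿ D g) ⟩
    F - G
      ≈⟨ +-cong (eval-applyUpTo-multiplicity xs<D) (-‿cong (eval-applyUpTo-multiplicity ys<D)) ⟩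
    powerSum xs t - powerSum ys t          ∎
    where
    f g : ℕ → Carrier
    f e = multiplicity e xs · 1#
    g e = multiplicity e ys · 1#
    F = eval (applyUpTo f D) t
    G = eval (applyUpTo g D) t

  Differ : List ℕ → List ℕ → Set ℓ
  Differ xs ys = ¬ (∀ e → multiplicity e xs · 1# ≈ multiplicity e ys · 1#)

  differ-sym : ∀ {xs ys} → Differ xs ys → Differ ys xs
  differ-sym xs≉ys ys≈xs = xs≉ys (λ e → sym (ys≈xs e))

  ·1-injective-01 : ∀ a b → a +ℕ b ≡ 1 → ¬ (a · 1# ≈ b · 1#)
  ·1-injective-01 0 1 _ 0≈1+0 = 0≉1 (trans 0≈1+0 (+-identityʳ 1#))
  ·1-injective-01 1 0 _ 1+0≈0 = 1+0≉0 1+0≈0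
  ·1-injective-01 0 (suc (suc _)) ()
  ·1-injective-01 1 (suc _)       ()
  ·1-injective-01 (suc (suc _)) _ ()

  differ-at : ∀ {xs ys} e → multiplicity e xs +ℕ multiplicity e ys ≡ 1 → Differ xs ys
  differ-at {xs} {ys} e sum≡1 xs≈ys =
    ·1-injective-01 (multiplicity e xs) (multiplicity e ys) sum≡1 (xs≈ys e)

  differencePolynomial-nonzero : ∀ {D xs ys} → All (_< D) xs → All (_< D) ys →
    Differ xs ys → ¬ All (_≈ 0#) (differencePolynomial D xs ys)
  differencePolynomial-nonzero {D} {xs} {ys} xs<D ys<D xs≉ys all≈0 = xs≉ys coefficient-≈
    where
    coefficient-≈ : ∀ e → multiplicity e xs · 1# ≈ multiplicity e ys · 1#
    coefficient-≈ e with e ℕ.<? D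
    ... | yes e<D = x∙y⁻¹≈ε⇒x≈y _ _ (All.applyUpTo⁻ _ D all≈0 e<D)
    ... | no  e≮D = reflexive (≡.cong (_· 1#) (≡.trans (absent xs<D) (≡.sym (absent ys<D))))
      where
      absent : ∀ {zs} → All (_< D) zs → multiplicity e zs ≡ 0
      absent = multiplicity-below ∘ All.map (λ z<D → ℕ.<-≤-trans z<D (ℕ.≮⇒≥ e≮D))

-- Roots of polynomials over a field

module FieldTheory {c ℓ} (F : Field c ℓ) where

  open Field F renaming (refl to ≈-refl)
  open DivisionRingTheory divisionRing
  open import Algebra.Properties.Ring ring
  open import Relation.Binary.Reasoning.Setoid setoid
  open import Algebra.Solver.CommutativeMonoid +-commutativeMonoid using (solve; _⊜_; _⊕_; id)
  open RawMonad (¬¬-Monad {c ⊔ ℓ})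

  -- The quotient of a ∷ as by x - r, which does not depend on a.
  divide : Carrier → List Carrier → List Carrier
  divide r []       = []
  divide r (b ∷ bs) = eval (b ∷ bs) r ∷ divide r bs

  length-divide : ∀ r as → length (divide r as) ≡ length as
  length-divide r []       = ≡.refl
  length-divide r (b ∷ bs) = ≡.cong suc (length-divide r bs)

  eval-divide : ∀ r t a as → eval (a ∷ as) t ≈ (t - r) * eval (divide r as) t + eval (a ∷ as) r
  eval-divide r t a [] = begin
    a + t * 0#                   ≈⟨ +-congˡ (zeroʳ t) ⟩
    a + 0#                       ≈⟨ +-identityˡ _ ⟨
    0# + (a + 0#)                ≈⟨ +-cong (zeroʳ (t - r)) (+-congˡ (zeroʳ r)) ⟨
    (t - r) * 0# + (a + r * 0#)  ∎
  eval-divide r t a (b ∷ bs) = begin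
    a + t * eval (b ∷ bs) t               ≈⟨ +-congˡ (*-congˡ (eval-divide r t b bs)) ⟩
    a + t * ((t - r) * Qt + E)            ≈⟨ +-congˡ (distribˡ t _ E) ⟩
    a + (t * ((t - r) * Qt) + t * E)      ≈⟨ +-congˡ (+-cong commute split) ⟩
    a + ((t - r) * (t * Qt) + ((t - r) * E + r * E))
      ≈⟨ solve 4 (λ a x y z → a ⊕ (x ⊕ (y ⊕ z)) ⊜ (y ⊕ x) ⊕ (a ⊕ z)) ≈-refl a _ _ _ ⟩
    ((t - r) * E + (t - r) * (t * Qt)) + (a + r * E)  ≈⟨ +-congʳ (distribˡ (t - r) E (t * Qt)) ⟨
    (t - r) * (E + t * Qt) + (a + r * E)  ∎
    where
    Qt = eval (divide r bs) t
    E  = eval (b ∷ bs) r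
    commute : t * ((t - r) * Qt) ≈ (t - r) * (t * Qt)
    commute = trans (sym (*-assoc t _ Qt)) (trans (*-congʳ (*-comm t (t - r))) (*-assoc (t - r) t Qt))
    split : t * E ≈ (t - r) * E + r * E
    split = begin
      t * E                  ≈⟨ *-congʳ (+-identityʳ t) ⟨
      (t + 0#) * E           ≈⟨ *-congʳ (+-congˡ (-‿inverseˡ r)) ⟨
      (t + (- r + r)) * E    ≈⟨ *-congʳ (+-assoc t (- r) r) ⟨
      ((t - r) + r) * E      ≈⟨ distribʳ E (t - r) r ⟩
      (t - r) * E + r * E    ∎

  divide-all≈0 : ∀ r a as → eval (a ∷ as) r ≈ 0# → All (_≈ 0#) (divide r as) →
    All (_≈ 0#) (a ∷ as)
  divide-all≈0 r a [] root [] = trans (sym (trans (+-congˡ (zeroʳ r)) (+-identityʳ a))) root ∷ []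
  divide-all≈0 r a (b ∷ bs) root (E≈0 ∷ rest≈0) = a≈0 ∷ divide-all≈0 r b bs E≈0 rest≈0
    where
    a≈0 : a ≈ 0#
    a≈0 = begin
      a                          ≈⟨ +-identityʳ a ⟨
      a + 0#                     ≈⟨ +-congˡ (zeroʳ r) ⟨
      a + r * 0#                 ≈⟨ +-congˡ (*-congˡ E≈0) ⟨
      a + r * eval (b ∷ bs) r    ≈⟨ root ⟩
      0#                         ∎

  RootCover : List Carrier → List Carrier → Set (c ⊔ ℓ)
  RootCover cs S = All (λ x → eval cs x ≈ 0#) S × (∀ t → eval cs t ≈ 0# → ¬ ¬ Any (t ≈_) S)

  extend-rootCover : ∀ {a as} r → eval (a ∷ as) r ≈ 0# →
    Σ (List Carrier) (RootCover (divide r as)) → Σ (List Carrier) (RootCover (a ∷ as))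
  extend-rootCover {a} {as} r root (S , roots , covers) = r ∷ S , root ∷ All.map lift roots , covers′
    where
    lift : ∀ {x} → eval (divide r as) x ≈ 0# → eval (a ∷ as) x ≈ 0#
    lift {x} q≈0 = begin
      eval (a ∷ as) x                                   ≈⟨ eval-divide r x a as ⟩
      (x - r) * eval (divide r as) x + eval (a ∷ as) r  ≈⟨ +-cong (*-congˡ q≈0) root ⟩
      (x - r) * 0# + 0#                                 ≈⟨ +-identityʳ _ ⟩
      (x - r) * 0#                                      ≈⟨ zeroʳ _ ⟩
      0#                                                ∎
    factor : ∀ t → eval (a ∷ as) t ≈ 0# → (t - r) * eval (divide r as) t ≈ 0#
    factor t root-t = begin
      (t - r) * eval (divide r as) t                    ≈⟨ +-identityʳ _ ⟨
      (t - r) * eval (divide r as) t + 0#               ≈⟨ +-congˡ root ⟨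
      (t - r) * eval (divide r as) t + eval (a ∷ as) r  ≈⟨ eval-divide r t a as ⟨
      eval (a ∷ as) t                                   ≈⟨ root-t ⟩
      0#                                                ∎
    covers′ : ∀ t → eval (a ∷ as) t ≈ 0# → ¬ ¬ Any (t ≈_) (r ∷ S)
    covers′ t root-t t∉ = covers t (x*y≈0⇒y≈0 t-r≉0 (factor t root-t)) (t∉ ∘ there)
      where
      t-r≉0 : ¬ (t - r ≈ 0#)
      t-r≉0 t-r≈0 = t∉ (here (x∙y⁻¹≈ε⇒x≈y t r t-r≈0))

  rootCover : ∀ cs → ¬ All (_≈ 0#) cs → ¬ ¬ Σ (List Carrier) (RootCover cs)
  rootCover cs = go (length cs) cs ℕ.≤-refl
    where
    go : ∀ m cs → length cs ≤ m → ¬ All (_≈ 0#) cs → ¬ ¬ Σ (List Carrier) (RootCover cs)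
    go m       []       _         nonzero = contradiction [] nonzero
    go (suc m) (a ∷ as) (s≤s len) nonzero = ¬¬-excluded-middle >>= λ where
      (no  no-root)    → pure ([] , [] , λ t root _ → no-root (t , root))
      (yes (r , root)) → ¬¬-map (extend-rootCover {a} {as} r root)
        (go m (divide r as) (ℕ.≤-trans (ℕ.≤-reflexive (length-divide r as)) len)
            (nonzero ∘ divide-all≈0 r a as root))

  record ExceptionalSet (P : Carrier → Set ℓ) : Set (c ⊔ ℓ) where
    constructor exceptional
    field
      points    : List Carrier
      algebraic : All (AlgebraicOverPrime divisionRing) points
      covers    : ∀ t → P t → ¬ ¬ Any (t ≈_) points

  exceptional-roots : ∀ cs → All InPrimeSubfield cs → ¬ All (_≈ 0#) cs →
    ¬ ¬ ExceptionalSet (λ t → eval cs t ≈ 0#)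
  exceptional-roots cs prime nonzero = do
    S , roots , covers ← rootCover cs nonzero
    some-nonzero ← ¬All⇒¬¬Any¬ nonzero
    pure (exceptional S (All.map (λ root → cs , prime , some-nonzero , root) roots) covers)

  exceptional-weaken : ∀ {P P′ : Carrier → Set ℓ} → (∀ t → P t → P′ t) →
    ExceptionalSet P′ → ExceptionalSet P
  exceptional-weaken P⇒P′ (exceptional S algebraic covers) =
    exceptional S algebraic (λ t → covers t ∘ P⇒P′ t)

  exceptional-any : ∀ {A : Set} {P : A → Carrier → Set ℓ} (xs : List A) →
    (∀ x → ¬ ¬ ExceptionalSet (P x)) → ¬ ¬ ExceptionalSet (λ t → Any (λ x → P x t) xs)
  exceptional-any []       _          = pure (exceptional [] [] (λ t ()))
  exceptional-any (x ∷ xs) exceptions = do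
    exceptional S₁ alg₁ covers₁ ← exceptions x
    exceptional S₂ alg₂ covers₂ ← exceptional-any xs exceptions
    pure (exceptional (S₁ ++ S₂) (All.++⁺ alg₁ alg₂) λ where
      t (here  Px)  → ¬¬-map Any.++⁺ˡ (covers₁ t Px)
      t (there Pxs) → ¬¬-map (Any.++⁺ʳ S₁) (covers₂ t Pxs))

-- The system Φₙ for n = p + 2

module Construction (p : ℕ) where

  n : ℕ
  n = suc (suc p)

  lowerTerms : List ℕ
  lowerTerms = replicate n (suc p) ++ replicate (suc p) p

  wTerms : List ℕ
  wTerms = suc n ∷ lowerTerms

  K : ℕ
  K = length lowerTerms

  tag : ℕ → ℕ
  tag j = suc (j +ℕ suc n)

  T₀ : ℕ
  T₀ = K +ℕ suc n

  T : ℕ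
  T = tag K

  1+p<1+n : suc p < suc n
  1+p<1+n = ℕ.m<n+m (suc p) {2} (s≤s z≤n)

  p<1+n : p < suc n
  p<1+n = ℕ.m<n+m p {3} (s≤s z≤n)

  lowerTerms<1+n : All (_< suc n) lowerTerms
  lowerTerms<1+n = All.++⁺ (All.replicate⁺ n 1+p<1+n) (All.replicate⁺ (suc p) p<1+n)

  1+n<tag : ∀ j → suc n < tag j
  1+n<tag j = s≤s (ℕ.m≤n+m (suc n) j)

  wTerms<tag : ∀ j → All (_< tag j) wTerms
  wTerms<tag j = 1+n<tag j ∷ All.map (λ x<1+n → ℕ.<-trans x<1+n (1+n<tag j)) lowerTerms<1+n

  tag-injective : ∀ {j j′} → tag j ≡ tag j′ → j ≡ j′
  tag-injective = ℕ.+-cancelʳ-≡ _ _ _ ∘ ℕ.suc-injective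

  ≤1+n⇒≤T : ∀ {e} → e ≤ suc n → e ≤ T
  ≤1+n⇒≤T e≤1+n = ℕ.≤-trans e≤1+n (ℕ.≤-trans (ℕ.m≤n+m (suc n) K) (ℕ.n≤1+n T₀))

  tag≤T : ∀ {j} → j ≤ K → tag j ≤ T
  tag≤T j≤K = s≤s (ℕ.+-monoˡ-≤ (suc n) j≤K)

  p≤T : p ≤ T
  p≤T = ≤1+n⇒≤T (ℕ.<⇒≤ p<1+n)

  p<T : p < T
  p<T = ≤1+n⇒≤T (ℕ.<⇒≤ 1+p<1+n)

  n<T : n < T
  n<T = ≤1+n⇒≤T ℕ.≤-refl

  nth-lowerTerms<1+n : ∀ k → nth lowerTerms k < suc n
  nth-lowerTerms<1+n k = All-nth k (s≤s z≤n) lowerTerms<1+n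

  nth-lowerTerms≤T : ∀ k → nth lowerTerms k ≤ T
  nth-lowerTerms≤T k = ≤1+n⇒≤T (ℕ.<⇒≤ (nth-lowerTerms<1+n k))

  -- With t = y₁: Y e = t^(1+e), U = t^(n-1) + t^(n-2), W = w, H j = (first j+1 monomials of w)
  -- + t^(tag j), M k = (monomial k+1 of w) + t^(tag (k+1)) and A k = H k + M k = H (k+1) + t^(tag k).
  -- The bounds are irrelevant, so two variables are equal as soon as their indices are.
  data V : Set where
    X0 X1 U W : V
    Y     : (e : ℕ) → .(e < T) → V
    M A   : (k : ℕ) → .(k < K) → V
    H     : (j : ℕ) → .(j ≤ K) → V

  y-var : Fin (suc n) → V
  y-var i = Y (toℕ i) (≤1+n⇒≤T (Fin.toℕ<n i))

  power : (e : ℕ) → .(e ≤ T) → V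
  power zero    _    = X1
  power (suc e) e<T  = Y e e<T

  mTerms : ℕ → List ℕ
  mTerms k = nth lowerTerms k ∷ tag (suc k) ∷ []

  hTerms : ℕ → List ℕ
  hTerms j = tag j ∷ take (suc j) wTerms

  terms : V → List ℕ
  terms X0      = []
  terms X1      = 0 ∷ []
  terms U       = suc p ∷ p ∷ []
  terms W       = wTerms
  terms (Y e _) = suc e ∷ []
  terms (M k _) = mTerms k
  terms (H j _) = hTerms j
  terms (A k _) = hTerms k ++ mTerms k

  infix 4 _≐_⊕_ _≐_⊛_
  data Equation : Set where
    _≐_⊕_ _≐_⊛_ : V → V → V → Equation

  u-equation : Equation
  u-equation = U ≐ power (suc p) p<T ⊕ power p p≤T

  h-base : Equation
  h-base = H 0 z≤n ≐ power (tag 0) (tag≤T z≤n) ⊕ power (suc n) n<T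

  w-equation : Equation
  w-equation = H K ℕ.≤-refl ≐ power (tag K) ℕ.≤-refl ⊕ W

  y-equation : (e : ℕ) → .(e < T₀) → Equation
  y-equation e e<T₀ = Y (suc e) (s≤s e<T₀) ≐ Y 0 (s≤s z≤n) ⊛ Y e (ℕ.m<n⇒m<1+n e<T₀)

  m-equation : (k : ℕ) → .(k < K) → Equation
  m-equation k k<K =
    M k k<K ≐ power (nth lowerTerms k) (nth-lowerTerms≤T k) ⊕ power (tag (suc k)) (tag≤T k<K)

  a-equation : (k : ℕ) → .(k < K) → Equation
  a-equation k k<K = A k k<K ≐ H k (ℕ.<⇒≤ k<K) ⊕ M k k<K

  h-step : (k : ℕ) → .(k < K) → Equation
  h-step k k<K = A k k<K ≐ H (suc k) k<K ⊕ power (tag k) (tag≤T (ℕ.<⇒≤ k<K))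

  equations : List Equation
  equations = u-equation ∷ h-base ∷ w-equation
    ∷ tabulate< T₀ y-equation ++ tabulate< K m-equation ++ tabulate< K a-equation ++ tabulate< K h-step

  record AllEquations {q} (P : Equation → Set q) : Set q where
    field
      u      : P u-equation
      base   : P h-base
      w      : P w-equation
      y      : ∀ e .(e<T₀ : e < T₀) → P (y-equation e e<T₀)
      m      : ∀ k .(k<K : k < K) → P (m-equation k k<K)
      a      : ∀ k .(k<K : k < K) → P (a-equation k k<K)
      step   : ∀ k .(k<K : k < K) → P (h-step k k<K)

  module _ {q} {P : Equation → Set q} where

    allEquations⁺ : AllEquations P → All P equations
    allEquations⁺ all = u ∷ base ∷ w ∷ All.++⁺ (All-tabulate<⁺ y) (All.++⁺ (All-tabulate<⁺ m)
                                        (All.++⁺ (All-tabulate<⁺ a) (All-tabulate<⁺ step)))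
      where open AllEquations all

    allEquations⁻ : All P equations → AllEquations P
    allEquations⁻ (u ∷ base ∷ w ∷ families) = record
      { u = u ; base = base ; w = w
      ; y    = All-tabulate<⁻ (All.++⁻ˡ (tabulate< T₀ y-equation) families)
      ; m    = All-tabulate<⁻ (All.++⁻ˡ (tabulate< K m-equation) families₁)
      ; a    = All-tabulate<⁻ (All.++⁻ˡ (tabulate< K a-equation) families₂)
      ; step = All-tabulate<⁻ (All.++⁻ʳ (tabulate< K a-equation) families₂)
      }
      where
      families₁ = All.++⁻ʳ (tabulate< T₀ y-equation) families
      families₂ = All.++⁻ʳ (tabulate< K m-equation) families₁

  gadgets : ℕ
  gadgets = K +ℕ (suc K +ℕ K)

  N : ℕ
  N = T +ℕ (2 +ℕ gadgets)

  gadget-var : Fin gadgets → Fin (2 +ℕ N)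
  gadget-var x = Fin.suc (Fin.suc (T ↑ʳ Fin.suc (Fin.suc x)))

  encode-var : V → Fin (2 +ℕ N)
  encode-var X0      = Fin.zero
  encode-var X1      = Fin.suc Fin.zero
  encode-var (Y e h) = Fin.suc (Fin.suc (fromℕ< h ↑ˡ 2 +ℕ gadgets))
  encode-var U       = Fin.suc (Fin.suc (T ↑ʳ Fin.zero))
  encode-var W       = Fin.suc (Fin.suc (T ↑ʳ Fin.suc Fin.zero))
  encode-var (M k h) = gadget-var (fromℕ< h ↑ˡ suc K +ℕ K)
  encode-var (H j h) = gadget-var (K ↑ʳ (fromℕ< (s≤s h) ↑ˡ K))
  encode-var (A k h) = gadget-var (K ↑ʳ (suc K ↑ʳ fromℕ< h))

  decode-HA : Fin (suc K) ⊎ Fin K → V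
  decode-HA = [ (λ j → H (toℕ j) (ℕ.≤-pred (Fin.toℕ<n j))) , (λ k → A (toℕ k) (Fin.toℕ<n k)) ]′

  decode-gadget : Fin K ⊎ Fin (suc K +ℕ K) → V
  decode-gadget = [ (λ k → M (toℕ k) (Fin.toℕ<n k)) , decode-HA ∘ splitAt (suc K) ]′

  decode-rest : Fin (2 +ℕ gadgets) → V
  decode-rest Fin.zero              = U
  decode-rest (Fin.suc Fin.zero)    = W
  decode-rest (Fin.suc (Fin.suc x)) = decode-gadget (splitAt K x)

  decode-power-or-rest : Fin T ⊎ Fin (2 +ℕ gadgets) → V
  decode-power-or-rest = [ (λ e → Y (toℕ e) (Fin.toℕ<n e)) , decode-rest ]′

  decode-var : Fin (2 +ℕ N) → V
  decode-var Fin.zero              = X0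
  decode-var (Fin.suc Fin.zero)    = X1
  decode-var (Fin.suc (Fin.suc x)) = decode-power-or-rest (splitAt T x)

  index-cong : ∀ {P : ℕ → Set} (C : (k : ℕ) → .(P k) → V) {k k′} .{h : P k} .{h′ : P k′} →
    k ≡ k′ → C k h ≡ C k′ h′
  index-cong C refl = refl

  decode-encode : ∀ v → decode-var (encode-var v) ≡ v
  decode-encode X0 = refl
  decode-encode X1 = refl
  decode-encode U rewrite Fin.splitAt-↑ʳ T (2 +ℕ gadgets) Fin.zero = refl
  decode-encode W rewrite Fin.splitAt-↑ʳ T (2 +ℕ gadgets) (Fin.suc Fin.zero) = refl
  decode-encode (Y e h) rewrite Fin.splitAt-↑ˡ T (fromℕ< h) (2 +ℕ gadgets) = index-cong Y (Fin.toℕ-fromℕ< h)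
  decode-encode (M k h)
    rewrite Fin.splitAt-↑ʳ T (2 +ℕ gadgets) (Fin.suc (Fin.suc (fromℕ< h ↑ˡ suc K +ℕ K)))
          | Fin.splitAt-↑ˡ K (fromℕ< h) (suc K +ℕ K) = index-cong M (Fin.toℕ-fromℕ< h)
  decode-encode (H j h)
    rewrite Fin.splitAt-↑ʳ T (2 +ℕ gadgets) (Fin.suc (Fin.suc (K ↑ʳ (fromℕ< (s≤s h) ↑ˡ K))))
          | Fin.splitAt-↑ʳ K (suc K +ℕ K) (fromℕ< (s≤s h) ↑ˡ K)
          | Fin.splitAt-↑ˡ (suc K) (fromℕ< (s≤s h)) K = index-cong H (Fin.toℕ-fromℕ< (s≤s h))
  decode-encode (A k h)
    rewrite Fin.splitAt-↑ʳ T (2 +ℕ gadgets) (Fin.suc (Fin.suc (K ↑ʳ (suc K ↑ʳ fromℕ< h))))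
          | Fin.splitAt-↑ʳ K (suc K +ℕ K) (suc K ↑ʳ fromℕ< h)
          | Fin.splitAt-↑ʳ (suc K) K (fromℕ< h) = index-cong A (Fin.toℕ-fromℕ< h)

  encode-decode-HA : ∀ s → encode-var (decode-HA s) ≡ gadget-var (K ↑ʳ join (suc K) K s)
  encode-decode-HA (inj₁ j) = ≡.cong (λ i → gadget-var (K ↑ʳ (i ↑ˡ K))) (Fin.fromℕ<-toℕ j _)
  encode-decode-HA (inj₂ k) = ≡.cong (λ i → gadget-var (K ↑ʳ (suc K ↑ʳ i))) (Fin.fromℕ<-toℕ k _)

  encode-decode-gadget : ∀ s → encode-var (decode-gadget s) ≡ gadget-var (join K (suc K +ℕ K) s)
  encode-decode-gadget (inj₁ k) = ≡.cong (λ i → gadget-var (i ↑ˡ _)) (Fin.fromℕ<-toℕ k (Fin.toℕ<n k))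
  encode-decode-gadget (inj₂ x) =
    ≡.trans (encode-decode-HA (splitAt (suc K) x))
            (≡.cong (gadget-var ∘ (K ↑ʳ_)) (Fin.join-splitAt (suc K) K x))

  encode-decode-power-or-rest : ∀ s → encode-var (decode-power-or-rest s) ≡ Fin.suc (Fin.suc (join T _ s))
  encode-decode-power-or-rest (inj₁ e) =
    ≡.cong (λ i → Fin.suc (Fin.suc (i ↑ˡ _))) (Fin.fromℕ<-toℕ e (Fin.toℕ<n e))
  encode-decode-power-or-rest (inj₂ Fin.zero)              = refl
  encode-decode-power-or-rest (inj₂ (Fin.suc Fin.zero))    = refl
  encode-decode-power-or-rest (inj₂ (Fin.suc (Fin.suc x))) =
    ≡.trans (encode-decode-gadget (splitAt K x)) (≡.cong gadget-var (Fin.join-splitAt K _ x))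

  encode-decode : ∀ x → encode-var (decode-var x) ≡ x
  encode-decode Fin.zero              = refl
  encode-decode (Fin.suc Fin.zero)    = refl
  encode-decode (Fin.suc (Fin.suc x)) =
    ≡.trans (encode-decode-power-or-rest (splitAt T x)) (≡.cong (Fin.suc ∘ Fin.suc) (Fin.join-splitAt T _ x))

  decode-injective : ∀ {x x′} → decode-var x ≡ decode-var x′ → x ≡ x′
  decode-injective {x} {x′} eq =
    ≡.trans (≡.sym (encode-decode x)) (≡.trans (≡.cong encode-var eq) (encode-decode x′))

  encode-injective : ∀ {v v′} → encode-var v ≡ encode-var v′ → v ≡ v′
  encode-injective {v} {v′} eq =
    ≡.trans (≡.sym (decode-encode v)) (≡.trans (≡.cong decode-var eq) (decode-encode v′))

  encode : Equation → Eqn (2 +ℕ N)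
  encode (v ≐ v₁ ⊕ v₂) = add (encode-var v) (encode-var v₁) (encode-var v₂)
  encode (v ≐ v₁ ⊛ v₂) = mul (encode-var v) (encode-var v₁) (encode-var v₂)

  Admissible : Equation → Set
  Admissible (v ≐ v₁ ⊕ v₂) = v₁ ≢ X0 × v₂ ≢ X0 × v₂ ≢ v × v ≢ v₁
  Admissible (v ≐ v₁ ⊛ v₂) =
    v ≢ X0 × v ≢ X1 × v₁ ≢ X0 × v₁ ≢ X1 × v₂ ≢ X0 × v₂ ≢ X1 × v₂ ≢ v × v ≢ v₁

  encode-admissible : ∀ eq → Admissible eq → AdmissibleEqn (encode eq)
  encode-admissible (v ≐ v₁ ⊕ v₂) (a , b , c , d) = enc a , enc b , enc c , enc d
    where enc = λ {v v′ : V} (v≢v′ : v ≢ v′) → v≢v′ ∘ encode-injective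
  encode-admissible (v ≐ v₁ ⊛ v₂) (a , b , c , d , e , f , g , h) =
    enc a , enc b , enc c , enc d , enc e , enc f , enc g , enc h
    where enc = λ {v v′ : V} (v≢v′ : v ≢ v′) → v≢v′ ∘ encode-injective

  power≢ : ∀ e .{h : e ≤ T} {v} → v ≢ X1 → (∀ {e′} .{h′ : e′ < T} → v ≢ Y e′ h′) → power e h ≢ v
  power≢ zero    v≢X1 v≢Y = v≢X1 ∘ ≡.sym
  power≢ (suc e) v≢X1 v≢Y = v≢Y ∘ ≡.sym

  admissible : AllEquations Admissible
  admissible = record
    { u    = (λ ()) , power≢ p (λ ()) (λ ()) , power≢ p (λ ()) (λ ()) , (λ ())
    ; base = (λ ()) , (λ ()) , (λ ()) , (λ ())
    ; w    = (λ ()) , (λ ()) , (λ ()) , (λ ())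
    ; y    = λ e _ → (λ ()) , (λ ()) , (λ ()) , (λ ()) , (λ ()) , (λ ()) , (λ ()) , (λ ())
    ; m    = λ k _ → power≢ (nth lowerTerms k) (λ ()) (λ ()) , (λ ()) , (λ ())
                   , power≢ (nth lowerTerms k) (λ ()) (λ ()) ∘ ≡.sym
    ; a    = λ k _ → (λ ()) , (λ ()) , (λ ()) , (λ ())
    ; step = λ k _ → (λ ()) , (λ ()) , (λ ()) , (λ ())
    }

  Φ : System
  Φ = record
    { N          = N
    ; eqns       = map encode equations
    ; admissible = All.map⁺ (All.map (encode-admissible _) (allEquations⁺ admissible))
    }

  top : V → ℕ
  top X0      = 0
  top X1      = 0
  top U       = suc p
  top W       = suc n
  top (Y e _) = suc e
  top (M k _) = tag (suc k)
  top (H j _) = tag j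
  top (A k _) = tag (suc k)

  nth-lowerTerms<tag : ∀ k j → nth lowerTerms k < tag j
  nth-lowerTerms<tag k j = ℕ.<-trans (nth-lowerTerms<1+n k) (1+n<tag j)

  take-wTerms<tag : ∀ m j → All (_< tag j) (take m wTerms)
  take-wTerms<tag m j = All.take⁺ m (wTerms<tag j)

  terms-≤-top : ∀ v → All (_≤ top v) (terms v)
  terms-≤-top X0        = []
  terms-≤-top X1        = z≤n ∷ []
  terms-≤-top U         = ℕ.≤-refl ∷ ℕ.n≤1+n p ∷ []
  terms-≤-top W         = ℕ.≤-refl ∷ All.map ℕ.<⇒≤ lowerTerms<1+n
  terms-≤-top (Y e _)   = ℕ.≤-refl ∷ []
  terms-≤-top (M k _)   = ℕ.<⇒≤ (nth-lowerTerms<tag k (suc k)) ∷ ℕ.≤-refl ∷ []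
  terms-≤-top (H j _)   = ℕ.≤-refl ∷ All.map ℕ.<⇒≤ (take-wTerms<tag (suc j) j)
  terms-≤-top (A k k<K) = All.++⁺ (All.map ℕ.m≤n⇒m≤1+n (terms-≤-top (H k (ℕ.<⇒≤ k<K))))
                                  (terms-≤-top (M k k<K))

  top≤T : ∀ v → top v ≤ T
  top≤T X0        = z≤n
  top≤T X1        = z≤n
  top≤T U         = p<T
  top≤T W         = n<T
  top≤T (Y e e<T) = recompute (suc e ℕ.≤? T) e<T
  top≤T (M k k<K) = tag≤T (recompute (k ℕ.<? K) k<K)
  top≤T (H j j≤K) = tag≤T (recompute (j ℕ.≤? K) j≤K)
  top≤T (A k k<K) = tag≤T (recompute (k ℕ.<? K) k<K)

  multiplicity-top : ∀ v → 0 < top v → multiplicity (top v) (terms v) ≡ 1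
  multiplicity-top U         _ = multiplicity-once [] (p ∷ []) [] (ℕ.<⇒≢ (ℕ.n<1+n p) ∷ [])
  multiplicity-top W         _ = multiplicity-once [] lowerTerms [] (All.map ℕ.<⇒≢ lowerTerms<1+n)
  multiplicity-top (Y e _)   _ = multiplicity-once {suc e} [] [] [] []
  multiplicity-top (M k _)   _ =
    multiplicity-once (nth lowerTerms k ∷ []) [] (ℕ.<⇒≢ (nth-lowerTerms<tag k (suc k)) ∷ []) []
  multiplicity-top (H j _)   _ =
    multiplicity-once [] (take (suc j) wTerms) [] (All.map ℕ.<⇒≢ (take-wTerms<tag (suc j) j))
  multiplicity-top (A k k<K) _ = begin
    multiplicity (tag (suc k)) (hTerms k ++ mTerms k)
      ≡⟨ multiplicity-++ (tag (suc k)) (hTerms k) (mTerms k) ⟩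
    multiplicity (tag (suc k)) (hTerms k) +ℕ multiplicity (tag (suc k)) (mTerms k)
      ≡⟨ ≡.cong₂ _+ℕ_ (multiplicity-below (ℕ.n<1+n (tag k) ∷ take-wTerms<tag (suc k) (suc k)))
                      (multiplicity-top (M k k<K) (s≤s z≤n)) ⟩
    1  ∎
    where open ≡.≡-Reasoning

  record Separated (v v′ : V) : Set where
    constructor separated
    field
      exponent : ℕ
      sum≡1    : multiplicity exponent (terms v) +ℕ multiplicity exponent (terms v′) ≡ 1

  separated-sym : ∀ {v v′} → Separated v v′ → Separated v′ v
  separated-sym {v} {v′} (separated e sum≡1) =
    separated e (≡.trans (ℕ.+-comm (multiplicity e (terms v′)) _) sum≡1)

  separated-at : ∀ {v v′} e → multiplicity e (terms v) ≡ 0 → multiplicity e (terms v′) ≡ 1 →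
    Separated v v′
  separated-at e m≡0 m′≡1 = separated e (≡.cong₂ _+ℕ_ m≡0 m′≡1)

  separated-by-top : ∀ v v′ → top v < top v′ → Separated v v′
  separated-by-top v v′ top<top′ = separated-at (top v′)
    (multiplicity-below (All.map (λ x≤top → ℕ.≤-<-trans x≤top top<top′) (terms-≤-top v)))
    (multiplicity-top v′ (ℕ.≤-<-trans z≤n top<top′))

  multiplicity-mTerms-at : ∀ k → multiplicity (nth lowerTerms k) (mTerms k) ≡ 1
  multiplicity-mTerms-at k =
    multiplicity-once [] (tag (suc k) ∷ []) [] (ℕ.>⇒≢ (nth-lowerTerms<tag k (suc k)) ∷ [])

  multiplicity-mTerms-absent : ∀ {k x} → nth lowerTerms k ≢ x → tag (suc k) ≢ x →
    multiplicity x (mTerms k) ≡ 0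
  multiplicity-mTerms-absent nth≢x tag≢x = multiplicity-absent (nth≢x ∷ tag≢x ∷ [])

  multiplicity-hTerms-1+n : ∀ j → multiplicity (suc n) (hTerms j) ≡ 1
  multiplicity-hTerms-1+n j = multiplicity-once (tag j ∷ []) (take j lowerTerms)
    (ℕ.>⇒≢ (1+n<tag j) ∷ []) (All.map ℕ.<⇒≢ (All.take⁺ j lowerTerms<1+n))

  multiplicity-hTerms-tag : ∀ k → multiplicity (tag k) (hTerms (suc k)) ≡ 0
  multiplicity-hTerms-tag k =
    multiplicity-absent (ℕ.>⇒≢ (ℕ.n<1+n (tag k)) ∷ All.map ℕ.<⇒≢ (take-wTerms<tag (suc (suc k)) k))

  multiplicity-aTerms-tag : ∀ k → multiplicity (tag k) (hTerms k ++ mTerms k) ≡ 1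
  multiplicity-aTerms-tag k = multiplicity-once [] (take (suc k) wTerms ++ mTerms k) []
    (All.++⁺ (All.map ℕ.<⇒≢ (take-wTerms<tag (suc k) k))
             (ℕ.<⇒≢ (nth-lowerTerms<tag k k) ∷ ℕ.>⇒≢ (ℕ.n<1+n (tag k)) ∷ []))

  separated-Y-U : ∀ .{p<T : p < T} → Separated (Y p p<T) U
  separated-Y-U = separated-at p (multiplicity-absent (ℕ.>⇒≢ (ℕ.n<1+n p) ∷ []))
                                 (multiplicity-once (suc p ∷ []) [] (ℕ.>⇒≢ (ℕ.n<1+n p) ∷ []) [])

  separated-Y-M : ∀ k .{e<T : suc k +ℕ suc n < T} .{k<K : k < K} → Separated (Y (suc k +ℕ suc n) e<T) (M k k<K)
  separated-Y-M k = separated-at (nth lowerTerms k)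
    (multiplicity-absent (ℕ.>⇒≢ (nth-lowerTerms<tag k (suc k)) ∷ []))
                                 (multiplicity-mTerms-at k)

  separated-Y-H : ∀ j .{e<T : j +ℕ suc n < T} .{j≤K : j ≤ K} → Separated (Y (j +ℕ suc n) e<T) (H j j≤K)
  separated-Y-H j =
    separated-at (suc n) (multiplicity-absent (ℕ.>⇒≢ (1+n<tag j) ∷ [])) (multiplicity-hTerms-1+n j)

  separated-Y-A : ∀ k .{e<T : suc k +ℕ suc n < T} .{k<K : k < K} → Separated (Y (suc k +ℕ suc n) e<T) (A k k<K)
  separated-Y-A k =
    separated-at (tag k) (multiplicity-absent (ℕ.>⇒≢ (ℕ.n<1+n (tag k)) ∷ [])) (multiplicity-aTerms-tag k)

  separated-M-H : ∀ {k j} .{k<K : k < K} .{j≤K : j ≤ K} → suc k ≡ j → Separated (M k k<K) (H j j≤K)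
  separated-M-H {k} refl = separated-at (suc n)
    (multiplicity-mTerms-absent (ℕ.<⇒≢ (nth-lowerTerms<1+n k)) (ℕ.>⇒≢ (1+n<tag (suc k))))
    (multiplicity-hTerms-1+n (suc k))

  separated-M-A : ∀ {k k′} .{k<K : k < K} .{k′<K : k′ < K} → k ≡ k′ → Separated (M k k<K) (A k′ k′<K)
  separated-M-A {k} refl = separated-at (tag k)
    (multiplicity-mTerms-absent (ℕ.<⇒≢ (nth-lowerTerms<tag k k)) (ℕ.>⇒≢ (ℕ.n<1+n (tag k))))
    (multiplicity-aTerms-tag k)

  separated-H-A : ∀ {j k} .{j≤K : j ≤ K} .{k<K : k < K} → j ≡ suc k → Separated (H j j≤K) (A k k<K)
  separated-H-A {k = k} refl = separated-at (tag k) (multiplicity-hTerms-tag k) (multiplicity-aTerms-tag k)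

  Y-injective : ∀ {e e′} .{h : e < T} .{h′ : e′ < T} → Y e h ≡ Y e′ h′ → e ≡ e′
  Y-injective refl = refl

  Y≢W : ∀ {e} .{h : e < T} → Y e h ≢ W
  Y≢W ()

  IsWY : V → V → Set
  IsWY v v′ = v ≡ W × v′ ≡ Y n n<T

  tag≢1+p : ∀ j → tag j ≢ suc p
  tag≢1+p j = ℕ.>⇒≢ (ℕ.<-trans 1+p<1+n (1+n<tag j))

  tag≢1+n : ∀ j → tag j ≢ suc n
  tag≢1+n j = ℕ.>⇒≢ (1+n<tag j)

  same-top : ∀ v v′ → v ≢ v′ → top v ≡ top v′ → Separated v v′ ⊎ (IsWY v v′ ⊎ IsWY v′ v)
  same-top X0      X0      v≢v′ _  = contradiction refl v≢v′
  same-top X0      X1      _    _  = inj₁ (separated 0 refl)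
  same-top X1      X0      _    _  = inj₁ (separated 0 refl)
  same-top X1      X1      v≢v′ _  = contradiction refl v≢v′
  same-top U       U       v≢v′ _  = contradiction refl v≢v′
  same-top W       W       v≢v′ _  = contradiction refl v≢v′
  same-top (Y e _) (Y e _) v≢v′ refl = contradiction refl v≢v′
  same-top (M k _) (M k′ _) v≢v′ eq = contradiction (index-cong M (ℕ.suc-injective (tag-injective eq))) v≢v′
  same-top (H j _) (H j′ _) v≢v′ eq = contradiction (index-cong H (tag-injective eq)) v≢v′
  same-top (A k _) (A k′ _) v≢v′ eq = contradiction (index-cong A (ℕ.suc-injective (tag-injective eq))) v≢v′
  same-top (Y p _) U       _ refl = inj₁ separated-Y-U
  same-top U       (Y p _) _ refl = inj₁ (separated-sym separated-Y-U)
  same-top (Y n _) W       _ refl = inj₂ (inj₂ (refl , refl))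
  same-top W       (Y n _) _ refl = inj₂ (inj₁ (refl , refl))
  same-top (Y _ _) (M k _) _ refl = inj₁ (separated-Y-M k)
  same-top (M k _) (Y _ _) _ refl = inj₁ (separated-sym (separated-Y-M k))
  same-top (Y _ _) (H j _) _ refl = inj₁ (separated-Y-H j)
  same-top (H j _) (Y _ _) _ refl = inj₁ (separated-sym (separated-Y-H j))
  same-top (Y _ _) (A k _) _ refl = inj₁ (separated-Y-A k)
  same-top (A k _) (Y _ _) _ refl = inj₁ (separated-sym (separated-Y-A k))
  same-top (M k _) (H j _) _ eq = inj₁ (separated-M-H (tag-injective eq))
  same-top (H j _) (M k _) _ eq = inj₁ (separated-sym (separated-M-H (tag-injective (≡.sym eq))))
  same-top (M k _) (A k′ _) _ eq = inj₁ (separated-M-A (ℕ.suc-injective (tag-injective eq)))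
  same-top (A k _) (M k′ _) _ eq =
    inj₁ (separated-sym (separated-M-A (ℕ.suc-injective (tag-injective (≡.sym eq)))))
  same-top (H j _) (A k _) _ eq = inj₁ (separated-H-A (tag-injective eq))
  same-top (A k _) (H j _) _ eq = inj₁ (separated-sym (separated-H-A (tag-injective (≡.sym eq))))
  same-top U       (M k _) _ eq = contradiction (≡.sym eq) (tag≢1+p (suc k))
  same-top U       (H j _) _ eq = contradiction (≡.sym eq) (tag≢1+p j)
  same-top U       (A k _) _ eq = contradiction (≡.sym eq) (tag≢1+p (suc k))
  same-top (M k _) U       _ eq = contradiction eq (tag≢1+p (suc k))
  same-top (H j _) U       _ eq = contradiction eq (tag≢1+p j)
  same-top (A k _) U       _ eq = contradiction eq (tag≢1+p (suc k))
  same-top W       (M k _) _ eq = contradiction (≡.sym eq) (tag≢1+n (suc k))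
  same-top W       (H j _) _ eq = contradiction (≡.sym eq) (tag≢1+n j)
  same-top W       (A k _) _ eq = contradiction (≡.sym eq) (tag≢1+n (suc k))
  same-top (M k _) W       _ eq = contradiction eq (tag≢1+n (suc k))
  same-top (H j _) W       _ eq = contradiction eq (tag≢1+n j)
  same-top (A k _) W       _ eq = contradiction eq (tag≢1+n (suc k))
  same-top U       W       _ ()
  same-top W       U       _ ()
  same-top X0      U       _ ()
  same-top X0      W       _ ()
  same-top X0      (Y _ _) _ ()
  same-top X0      (M _ _) _ ()
  same-top X0      (H _ _) _ ()
  same-top X0      (A _ _) _ ()
  same-top X1      U       _ ()
  same-top X1      W       _ ()
  same-top X1      (Y _ _) _ ()
  same-top X1      (M _ _) _ ()
  same-top X1      (H _ _) _ ()
  same-top X1      (A _ _) _ ()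
  same-top U       X0      _ ()
  same-top W       X0      _ ()
  same-top (Y _ _) X0      _ ()
  same-top (M _ _) X0      _ ()
  same-top (H _ _) X0      _ ()
  same-top (A _ _) X0      _ ()
  same-top U       X1      _ ()
  same-top W       X1      _ ()
  same-top (Y _ _) X1      _ ()
  same-top (M _ _) X1      _ ()
  same-top (H _ _) X1      _ ()
  same-top (A _ _) X1      _ ()

  distinguishable : ∀ v v′ → v ≢ v′ → Separated v v′ ⊎ (IsWY v v′ ⊎ IsWY v′ v)
  distinguishable v v′ v≢v′ with ℕ.<-cmp (top v) (top v′)
  ... | tri< top<top′ _ _ = inj₁ (separated-by-top v v′ top<top′)
  ... | tri≈ _ top≡top′ _ = same-top v v′ v≢v′ top≡top′
  ... | tri> _ _ top>top′ = inj₁ (separated-sym (separated-by-top v′ v top>top′))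

  multiplicity-wTerms-1+p : multiplicity (suc p) wTerms ≡ n
  multiplicity-wTerms-1+p = begin
    δ (suc n) (suc p) +ℕ multiplicity (suc p) lowerTerms
      ≡⟨ ≡.cong (_+ℕ multiplicity (suc p) lowerTerms) (δ-≢ (ℕ.>⇒≢ 1+p<1+n)) ⟩
    multiplicity (suc p) lowerTerms
      ≡⟨ multiplicity-++ (suc p) (replicate n (suc p)) (replicate (suc p) p) ⟩
    multiplicity (suc p) (replicate n (suc p)) +ℕ multiplicity (suc p) (replicate (suc p) p)
      ≡⟨ ≡.cong₂ _+ℕ_ (multiplicity-replicate n (suc p))
                      (multiplicity-absent (All.replicate⁺ (suc p) (ℕ.<⇒≢ (ℕ.n<1+n p)))) ⟩
    n +ℕ 0
      ≡⟨ ℕ.+-identityʳ n ⟩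
    n ∎
    where open ≡.≡-Reasoning

  multiplicity-wTerms-p : multiplicity p wTerms ≡ suc p
  multiplicity-wTerms-p = begin
    δ (suc n) p +ℕ multiplicity p lowerTerms
      ≡⟨ ≡.cong (_+ℕ multiplicity p lowerTerms) (δ-≢ (ℕ.>⇒≢ p<1+n)) ⟩
    multiplicity p lowerTerms
      ≡⟨ multiplicity-++ p (replicate n (suc p)) (replicate (suc p) p) ⟩
    multiplicity p (replicate n (suc p)) +ℕ multiplicity p (replicate (suc p) p)
      ≡⟨ ≡.cong₂ _+ℕ_ (multiplicity-absent (All.replicate⁺ n (ℕ.>⇒≢ (ℕ.n<1+n p))))
                      (multiplicity-replicate (suc p) p) ⟩
    suc p ∎
    where open ≡.≡-Reasoning

  -- The intended values, and property (1)

  module Values {c ℓ} (Q : DivisionRing c ℓ) where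

    open DivisionRing Q renaming (refl to ≈-refl)
    open DivisionRingTheory Q
    open import Algebra.Properties.Ring ring
    open import Relation.Binary.Reasoning.Setoid setoid
    open import Algebra.Solver.CommutativeMonoid +-commutativeMonoid using (solve; _⊜_; _⊕_; id)

    Satisfied : (V → Carrier) → Equation → Set ℓ
    Satisfied r (v ≐ v₁ ⊕ v₂) = r v ≈ r v₁ + r v₂
    Satisfied r (v ≐ v₁ ⊛ v₂) = r v ≈ r v₁ * r v₂

    satisfied-resp : ∀ {r r′} → (∀ v → r v ≈ r′ v) → ∀ eq → Satisfied r eq → Satisfied r′ eq
    satisfied-resp r≈r′ (v ≐ v₁ ⊕ v₂) sat =
      trans (sym (r≈r′ v)) (trans sat (+-cong (r≈r′ v₁) (r≈r′ v₂)))
    satisfied-resp r≈r′ (v ≐ v₁ ⊛ v₂) sat =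
      trans (sym (r≈r′ v)) (trans sat (*-cong (r≈r′ v₁) (r≈r′ v₂)))

    satisfied⇒holds : ∀ {s} eq → Satisfied (s ∘ encode-var) eq → Holds Q s (encode eq)
    satisfied⇒holds (_ ≐ _ ⊕ _) sat = sat
    satisfied⇒holds (_ ≐ _ ⊛ _) sat = sat

    value : Carrier → V → Carrier
    value t v = powerSum (terms v) t

    value-power : ∀ t e .{h : e ≤ T} → value t (power e h) ≡ t ^ e + 0#
    value-power t zero    = ≡.refl
    value-power t (suc e) = ≡.refl

    value-satisfies : ∀ t → AllEquations (Satisfied (value t))
    value-satisfies t = record
      { u    = trans (powerSum-++ (suc p ∷ []) (p ∷ []) t) (+-congˡ (reflexive (≡.sym (value-power t p))))
      ; base = powerSum-++ (tag 0 ∷ []) (suc n ∷ []) t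
      ; w    = trans (reflexive (≡.cong (λ xs → powerSum (tag K ∷ suc n ∷ xs) t)
                                            (Data.List.Properties.take-all K lowerTerms ℕ.≤-refl)))
                     (powerSum-++ (tag K ∷ []) wTerms t)
      ; y    = λ e _ → square e
      ; m    = λ k _ → trans (powerSum-++ (nth lowerTerms k ∷ []) (tag (suc k) ∷ []) t)
                            (+-congʳ (reflexive (≡.sym (value-power t (nth lowerTerms k)))))
      ; a    = λ k k<K → powerSum-++ (terms (H k (ℕ.<⇒≤ k<K))) (terms (M k k<K)) t
      ; step = step
      }
      where
      square : ∀ e → t ^ suc (suc e) + 0# ≈ (t ^ 1 + 0#) * (t ^ suc e + 0#)
      square e = begin
        t * t ^ suc e + 0#                ≈⟨ +-identityʳ _ ⟩
        t * t ^ suc e                     ≈⟨ *-cong (*-identityʳ t) (+-identityʳ _) ⟨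
        (t * 1#) * (t ^ suc e + 0#)       ≈⟨ *-congʳ (+-identityʳ _) ⟨
        (t * 1# + 0#) * (t ^ suc e + 0#)  ∎
      step : ∀ k .(k<K : k < K) → Satisfied (value t) (h-step k k<K)
      step k k<K = begin
        powerSum ((tag k ∷ suc n ∷ take k lowerTerms) ++ nth lowerTerms k ∷ tag (suc k) ∷ []) t
          ≈⟨ powerSum-++ (tag k ∷ suc n ∷ take k lowerTerms) _ t ⟩
        (old + (lead + prefix)) + (next + (new + 0#))
          ≈⟨ solve 5 (λ a b c d e → (a ⊕ (b ⊕ c)) ⊕ (d ⊕ (e ⊕ id)) ⊜ (e ⊕ (b ⊕ (c ⊕ d))) ⊕ (a ⊕ id))
                   ≈-refl old lead prefix next new ⟩
        (new + (lead + (prefix + next))) + (old + 0#)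
          ≈⟨ +-congʳ (+-congˡ (+-congˡ (+-congˡ (+-identityʳ next)))) ⟨
        (new + (lead + (prefix + (next + 0#)))) + (old + 0#)
          ≈⟨ +-congʳ (+-congˡ (+-congˡ (powerSum-++ (take k lowerTerms) (nth lowerTerms k ∷ []) t))) ⟨
        (new + (lead + powerSum (take k lowerTerms ++ nth lowerTerms k ∷ []) t)) + (old + 0#)
          ≡⟨ ≡.cong (λ xs → (new + (lead + powerSum xs t)) + (old + 0#)) (take-suc-nth lowerTerms k k<K) ⟨
        (new + (lead + powerSum (take (suc k) lowerTerms) t)) + (old + 0#)  ∎
        where
        old    = t ^ tag k
        lead   = t ^ suc n
        prefix = powerSum (take k lowerTerms) t
        next   = t ^ nth lowerTerms k
        new    = t ^ tag (suc k)

    value-W : ∀ t → value t W ≈ (t ^ (n +ℕ 1) + n · t ^ (n ℕ.∸ 1)) + (n ℕ.∸ 1) · t ^ (n ℕ.∸ 2)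
    value-W t = begin
      t ^ suc n + powerSum (replicate n (suc p) ++ replicate (suc p) p) t
        ≈⟨ +-congˡ (powerSum-++ (replicate n (suc p)) (replicate (suc p) p) t) ⟩
      t ^ suc n + (powerSum (replicate n (suc p)) t + powerSum (replicate (suc p) p) t)
        ≡⟨ ≡.cong₂ (λ a b → t ^ suc n + (a + b))
                   (powerSum-replicate n (suc p) t) (powerSum-replicate (suc p) p t) ⟩
      t ^ suc n + (n · t ^ suc p + suc p · t ^ p)  ≈⟨ +-assoc _ _ _ ⟨
      (t ^ suc n + n · t ^ suc p) + suc p · t ^ p
        ≡⟨ ≡.cong (λ e → (t ^ e + n · t ^ suc p) + suc p · t ^ p) (ℕ.+-comm 1 n) ⟩
      (t ^ (n +ℕ 1) + n · t ^ suc p) + suc p · t ^ p  ∎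

    module Forced (s : Fin (2 +ℕ N) → Carrier) (solution : IsSolution Q Φ s) where

      open IsSolution solution using (at-x₀; at-x₁; distinct)

      r : V → Carrier
      r = s ∘ encode-var

      t : Carrier
      t = r (y-var Fin.zero)

      private
        module Solution = AllEquations (allEquations⁻ (All.map⁻ (IsSolution.equations solution)))
        module Intended = AllEquations (value-satisfies t)

      forced-Y : ∀ e .(e<T : e < T) → r (Y e e<T) ≈ value t (Y e e<T)
      forced-Y zero    _   = sym (trans (+-identityʳ _) (*-identityʳ t))
      forced-Y (suc e) e<T =
        product-determined (Solution.y e (ℕ.≤-pred e<T)) (Intended.y e (ℕ.≤-pred e<T))
          (forced-Y 0 (s≤s z≤n)) (forced-Y e (ℕ.<-trans (ℕ.n<1+n e) e<T))

      forced-power : ∀ e .(e≤T : e ≤ T) → r (power e e≤T) ≈ value t (power e e≤T)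
      forced-power zero    _   = trans at-x₁ (sym (+-identityʳ 1#))
      forced-power (suc e) e<T = forced-Y e e<T

      forced-M : ∀ k .(k<K : k < K) → r (M k k<K) ≈ value t (M k k<K)
      forced-M k k<K = sum-determined (Solution.m k k<K) (Intended.m k k<K)
        (forced-power (nth lowerTerms k) (nth-lowerTerms≤T k)) (forced-power (tag (suc k)) (tag≤T k<K))

      forced-H : ∀ j .(j≤K : j ≤ K) → r (H j j≤K) ≈ value t (H j j≤K)
      forced-A : ∀ k .(k<K : k < K) → r (A k k<K) ≈ value t (A k k<K)

      forced-H zero    _   = sum-determined Solution.base Intended.base
        (forced-power (tag 0) (tag≤T z≤n)) (forced-power (suc n) n<T)
      forced-H (suc k) k<K = left-summand-determined (Solution.step k k<K) (Intended.step k k<K)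
        (forced-A k k<K) (forced-power (tag k) (tag≤T (ℕ.<⇒≤ k<K)))

      forced-A k k<K = sum-determined (Solution.a k k<K) (Intended.a k k<K)
        (forced-H k (ℕ.<⇒≤ k<K)) (forced-M k k<K)

      forced : ∀ v → r v ≈ value t v
      forced X0      = at-x₀
      forced X1      = forced-power 0 z≤n
      forced U       = sum-determined Solution.u Intended.u (forced-power (suc p) p<T) (forced-power p p≤T)
      forced W       = right-summand-determined Solution.w Intended.w
                         (forced-H K ℕ.≤-refl) (forced-power (tag K) ℕ.≤-refl)
      forced (Y e h) = forced-Y e h
      forced (M k h) = forced-M k h
      forced (H j h) = forced-H j h
      forced (A k h) = forced-A k h

      values-of-y : ∀ i → r (y-var i) ≈ t ^ (1 +ℕ toℕ i)
      values-of-y i = trans (forced (Y (toℕ i) _)) (+-identityʳ _)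

      value-of-w : r W ≈ (t ^ (n +ℕ 1) + n · t ^ (n ℕ.∸ 1)) + (n ℕ.∸ 1) · t ^ (n ℕ.∸ 2)
      value-of-w = trans (forced W) (value-W t)

      u-nonzero : ¬ (t ^ (n ℕ.∸ 1) + t ^ (n ℕ.∸ 2) ≈ 0#)
      u-nonzero u≈0 = distinct (encode-var U) (encode-var X0) (λ ()) (begin
        r U                        ≈⟨ forced U ⟩
        t ^ suc p + (t ^ p + 0#)   ≈⟨ +-congˡ (+-identityʳ _) ⟩
        t ^ suc p + t ^ p          ≈⟨ u≈0 ⟩
        0#                         ≈⟨ at-x₀ ⟨
        r X0                       ∎)

  -- (2): the intended values form a solution for almost all t

  module Generic {c ℓ} (F : Field c ℓ) where

    open Field F renaming (refl to ≈-refl)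
    open DivisionRingTheory divisionRing
    open FieldTheory F
    open Values divisionRing
    open import Algebra.Properties.Ring ring
    open import Relation.Binary.Reasoning.Setoid setoid
    open RawMonad (¬¬-Monad {c ⊔ ℓ})

    D : ℕ
    D = suc T

    terms<D : ∀ v → All (_< D) (terms v)
    terms<D v = All.map (λ x≤top → s≤s (ℕ.≤-trans x≤top (top≤T v))) (terms-≤-top v)

    wTerms-differ : Differ wTerms (suc n ∷ [])
    wTerms-differ same = 1+0≉0 (begin
      1# + 0#           ≈⟨ +-congˡ (coefficient p multiplicity-wTerms-p (ℕ.>⇒≢ p<1+n)) ⟨
      1# + suc p · 1#   ≈⟨ coefficient (suc p) multiplicity-wTerms-1+p (ℕ.>⇒≢ (ℕ.m<n+m (suc p) {2} (s≤s z≤n))) ⟩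
      0#                ∎)
      where
      coefficient : ∀ e {m} → multiplicity e wTerms ≡ m → suc n ≢ e → m · 1# ≈ 0#
      coefficient e refl suc-n≢e =
        trans (same e) (reflexive (≡.cong (_· 1#) (multiplicity-absent (suc-n≢e ∷ []))))

    terms-differ : ∀ {v v′} → v ≢ v′ → Differ (terms v) (terms v′)
    terms-differ {v} {v′} v≢v′ with distinguishable v v′ v≢v′
    ... | inj₁ (separated e sum≡1)   = differ-at {terms v} {terms v′} e sum≡1
    ... | inj₂ (inj₁ (refl , refl)) = wTerms-differ
    ... | inj₂ (inj₂ (refl , refl)) = differ-sym {wTerms} {suc n ∷ []} wTerms-differ

    coincidence-exceptional : ∀ {v v′} → v ≢ v′ → ¬ ¬ ExceptionalSet (λ t → value t v ≈ value t v′)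
    coincidence-exceptional {v} {v′} v≢v′ = ¬¬-map (exceptional-weaken is-root)
      (exceptional-roots (differencePolynomial D (terms v) (terms v′))
        (All.applyUpTo⁺₂ _ D λ e →
          ·1-difference-inPrimeSubfield (multiplicity e (terms v)) (multiplicity e (terms v′)))
        (differencePolynomial-nonzero (terms<D v) (terms<D v′) (terms-differ v≢v′)))
      where
      is-root : ∀ t → value t v ≈ value t v′ → eval (differencePolynomial D (terms v) (terms v′)) t ≈ 0#
      is-root t v≈v′ = trans (eval-differencePolynomial t (terms<D v) (terms<D v′)) (x≈y⇒x∙y⁻¹≈ε v≈v′)

    generic : Carrier → Fin (2 +ℕ N) → Carrier
    generic t x = value t (decode-var x)

    Collision : Carrier → Set ℓ
    Collision t = Any (λ x → Any (λ x′ → x ≢ x′ × generic t x ≈ generic t x′) (allFin _)) (allFin _)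

    collisions-exceptional : ¬ ¬ ExceptionalSet Collision
    collisions-exceptional = exceptional-any (allFin _) λ x → exceptional-any (allFin _) λ x′ → pair x x′
      where
      pair : ∀ x x′ → ¬ ¬ ExceptionalSet (λ t → x ≢ x′ × generic t x ≈ generic t x′)
      pair x x′ with x Fin.≟ x′
      ... | yes refl  = pure (exceptional [] [] (λ t (x≢x , _) → contradiction refl x≢x))
      ... | no  x≢x′ =
        ¬¬-map (exceptional-weaken (λ t → proj₂)) (coincidence-exceptional (x≢x′ ∘ decode-injective))

    generic-encode : ∀ t v → value t v ≈ generic t (encode-var v)
    generic-encode t v = reflexive (≡.cong (value t) (≡.sym (decode-encode v)))

    generic-solution : ∀ t → ¬ Collision t → IsSolution divisionRing Φ (generic t)
    generic-solution t no-collision = record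
      { at-x₀     = ≈-refl
      ; at-x₁     = +-identityʳ 1#
      ; distinct  = λ x x′ x≢x′ x≈x′ →
          no-collision (lose (∈-allFin x) (lose (∈-allFin x′) (x≢x′ , x≈x′)))
      ; equations = All.map⁺ (All.map (λ {eq} → satisfied⇒holds eq ∘ satisfied-resp (generic-encode t) eq)
                                      (allEquations⁺ (value-satisfies t)))
      }

    GenericSolutions : Set (c ⊔ ℓ)
    GenericSolutions = Σ (List Carrier) λ S → All (AlgebraicOverPrime divisionRing) S ×
      (∀ t → ¬ Any (t ≈_) S → Σ (Fin (2 +ℕ N) → Carrier) λ s →
        IsSolution divisionRing Φ s × s (encode-var (y-var Fin.zero)) ≈ t)

    generic-solutions : ¬ ¬ GenericSolutions
    generic-solutions = ¬¬-map solutions collisions-exceptional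
      where
      solutions : ExceptionalSet Collision → GenericSolutions
      solutions (exceptional S algebraic covers) = S , algebraic , λ t t∉S →
        generic t , generic-solution t (λ collision → covers t collision t∉S) ,
        trans (sym (generic-encode t (y-var Fin.zero))) (trans (+-identityʳ _) (*-identityʳ t))

lemma2p2 : ∀ (n : ℕ) → 1 < n → Lemma2p2Data n
lemma2p2 (suc (suc p)) _ = record
  { Φ          = Φ
  ; y          = encode-var ∘ y-var
  ; w          = encode-var W
  ; y-distinct = λ i j i≢j → i≢j ∘ Fin.toℕ-injective ∘ Y-injective ∘ encode-injective
  ; y≢w        = λ i → Y≢W ∘ encode-injective
  ; property1  = λ Q s solution → let open Values.Forced Q s solution in values-of-y , value-of-w , u-nonzero
  ; property2  = Generic.generic-solutions
  }
  where open Construction p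
lemma2p2 (suc zero) (s≤s ())
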